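{- Let $b>2$ be an integer and let $p$ be the smallest prime dividing $b-1$. Then the maximum length $t$ of a run of consecutive positive integers $n,n+1,\dots,n+t-1$ that are all $b$-anti-Niven is $p-1$. Moreover, there exist infinitely many positive integers $n$ such that $n,n+1,\dots,n+p-2$ are all $b$-anti-Niven.
   Context: For a positive integer $n$ with base-$b$ expansion $n=\sum_{j=0}^m a_jb^j$ ($0\leq a_j\leq b-1$), $s_b(n)=\sum_{j=0}^m a_j$. A positive integer $n$ is $b$-anti-Niven if $\gcd(n,s_b(n))=1$. -}

module Defs where

open import Data.Nat using (ℕ; zero; suc; _+_; _<_; _≤_; NonZero)
open import Data.Nat.DivMod using (_/_; _%_)
open import Data.Nat.Coprimality using (Coprime)

-- base-b digit sum with explicit fuel; the fuel n suffices for input n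
-- (each step with b ≥ 2 strictly decreases a positive argument).
digitSumAux : (b : ℕ) → .{{NonZero b}} → ℕ → ℕ → ℕ
digitSumAux b zero    n = 0
digitSumAux b (suc f) zero = 0
digitSumAux b (suc f) n@(suc _) = n % b + digitSumAux b f (n / b)

s : (b : ℕ) → .{{NonZero b}} → ℕ → ℕ
s b n = digitSumAux b n n

AntiNiven : (b : ℕ) → .{{NonZero b}} → ℕ → Set
AntiNiven b n = (0 < n) × Coprime n (s b n)
  where open import Data.Product using (_×_)

AntiNivenRun : (b : ℕ) → .{{NonZero b}} → ℕ → ℕ → Set
AntiNivenRun b n t = ∀ i → i < t → AntiNiven b (n + i)

{-# OPTIONS --safe #-}

-- Since b ≡ 1 (mod b − 1), the digit sum s_b(n) is congruent to n modulo every divisor of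
-- b − 1. Among p consecutive integers one is divisible by p, and then so is its digit sum:
-- no run has length p. Conversely, pigeonhole on the powers of b modulo (p − 1)! gives
-- D > 0 with b^D ≡ 1 modulo every prime q < p not dividing b. For n = b^(1+Dt) and
-- i < p − 1 we have s_b(n + i) = i + 1, and a prime q dividing both is < p and divides
-- n − 1 = b (b^(Dt) − 1) + (b − 1); so q ∤ b, hence q ∣ b^(Dt) − 1 and q ∣ b − 1,
-- contradicting the minimality of p.

module Submission where

open import Defs
open import Data.Nat
open import Data.Nat.Properties
open import Data.Nat.DivMod
open import Data.Nat.Divisibility
open import Data.Nat.Primality
open import Data.Nat.Primality.Factorisation using (factorise)
open import Data.Nat.Coprimality using (Coprime)
open import Data.Nat.ListAction using (product)
open import Data.Nat.Tactic.RingSolver using (solve-∀)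
open import Data.Fin using (toℕ; fromℕ<)
open import Data.Fin.Properties using (pigeonhole; fromℕ<-injective)
open import Data.List using ([]; _∷_)
open import Data.List.Relation.Unary.All using (_∷_)
open import Data.Empty using (⊥; ⊥-elim)
open import Data.Sum using (inj₁; inj₂)
open import Data.Product using (_×_; _,_; proj₁; proj₂; map₂; ∃-syntax; ∃₂)
open import Relation.Nullary using (¬_; yes; no; contradiction)
open import Relation.Binary.PropositionalEquality

%-cong-+ˡ : ∀ {d} .{{_ : NonZero d}} x {y y′} → y % d ≡ y′ % d → (x + y) % d ≡ (x + y′) % d
%-cong-+ˡ {d} x {y} {y′} y≡y′ = begin
  (x + y) % d            ≡⟨ %-distribˡ-+ x y d ⟩
  (x % d + y % d) % d    ≡⟨ cong (λ z → (x % d + z) % d) y≡y′ ⟩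
  (x % d + y′ % d) % d   ≡⟨ %-distribˡ-+ x y′ d ⟨
  (x + y′) % d           ∎
  where open ≡-Reasoning

∃-multiple-within : ∀ n m .{{_ : NonZero m}} → ∃[ i ] (i < m × m ∣ n + i)
∃-multiple-within n m = i , m%n<n _ m , m%n≡0⇒n∣m (n + i) m n+i%m≡0
  where
    open ≡-Reasoning
    -- i ≡ (m − 1) n ≡ −n (mod m)
    i : ℕ
    i = pred m * n % m
    n+i%m≡0 : (n + i) % m ≡ 0
    n+i%m≡0 = begin
      (n + i) % m                           ≡⟨ %-distribˡ-+ n i m ⟩
      (n % m + i % m) % m                   ≡⟨ cong (λ w → (n % m + w) % m) (m%n%n≡m%n _ m) ⟩
      (n % m + pred m * n % m) % m          ≡⟨ %-distribˡ-+ n (pred m * n) m ⟨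
      (suc (pred m) * n) % m                ≡⟨ cong (λ w → (w * n) % m) (suc-pred m) ⟩
      (m * n) % m                           ≡⟨ cong (_% m) (*-comm m n) ⟩
      (n * m) % m                           ≡⟨ m*n%n≡0 n m ⟩
      0                                     ∎

prime-divisor : ∀ {d} → d ≢ 1 → ∃[ q ] (Prime q × q ∣ d)
prime-divisor {zero} _ = 2 , prime[2] , 2 ∣0
prime-divisor {suc zero} d≢1 = contradiction refl d≢1
prime-divisor {d@(suc (suc _))} _ with factorise d
... | record { factors = [] ; isFactorisation = d≡1 } = contradiction (suc-injective d≡1) 1+n≢0
... | record { factors = q ∷ qs ; isFactorisation = d≡q*qs ; factorsPrime = q-prime ∷ _ } =
  q , q-prime , subst (q ∣_) (sym d≡q*qs) (m∣m*n (product qs))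

¬common-prime⇒coprime : ∀ {x y} → (∀ q → Prime q → q ∣ x → q ∣ y → ⊥) → Coprime x y
¬common-prime⇒coprime no-common {d} (d∣x , d∣y) with d ≟ 1
... | yes d≡1 = d≡1
... | no d≢1 with q , q-prime , q∣d ← prime-divisor d≢1 =
  ⊥-elim (no-common q q-prime (∣-trans q∣d d∣x) (∣-trans q∣d d∣y))

prime∣^⇒∣ : ∀ {q} m k → Prime q → q ∣ m ^ k → q ∣ m
prime∣^⇒∣ m zero    q-prime q∣1 = contradiction (∣1⇒≡1 q∣1) (nonTrivial⇒≢1 {{prime⇒nonTrivial q-prime}})
prime∣^⇒∣ m (suc k) q-prime q∣m*m^k with euclidsLemma m (m ^ k) q-prime q∣m*m^k
... | inj₁ q∣m   = q∣m
... | inj₂ q∣m^k = prime∣^⇒∣ m k q-prime q∣m^k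

m≤n⇒m∣n! : ∀ {m n} .{{_ : NonZero m}} → m ≤ n → m ∣ n !
m≤n⇒m∣n! {suc m} m≤n = ∣-trans (m∣m*n (m !)) (m≤n⇒m!∣n! m≤n)

%-≡⇒∣∸ : ∀ M .{{_ : NonZero M}} x y → x % M ≡ y % M → M ∣ y ∸ x
%-≡⇒∣∸ M x y x≡y = divides (y / M ∸ x / M) (begin
  y ∸ x
    ≡⟨ cong₂ _∸_ (m≡m%n+[m/n]*n y M) (trans (m≡m%n+[m/n]*n x M) (cong (_+ x / M * M) x≡y)) ⟩
  (y % M + y / M * M) ∸ (y % M + x / M * M)
    ≡⟨ [m+n]∸[m+o]≡n∸o (y % M) _ _ ⟩
  y / M * M ∸ x / M * M
    ≡⟨ *-distribʳ-∸ M (y / M) (x / M) ⟨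
  (y / M ∸ x / M) * M ∎)
  where open ≡-Reasoning

[m*n]∸1≡m*[n∸1]+[m∸1] : ∀ m {n} → 0 < n → m * n ∸ 1 ≡ m * (n ∸ 1) + (m ∸ 1)
[m*n]∸1≡m*[n∸1]+[m∸1] zero    _ = refl
[m*n]∸1≡m*[n∸1]+[m∸1] (suc m) {suc n} _ =
  trans (cong (n +_) (*-suc m n)) (rearrange m n)
  where
    rearrange : ∀ m n → n + (m + m * n) ≡ n + m * n + m
    rearrange = solve-∀

∣∸1⇒∣^∸1 : ∀ {d} x → d ∣ x ∸ 1 → ∀ t → d ∣ x ^ t ∸ 1
∣∸1⇒∣^∸1 {d} x        _     zero    = d ∣0
∣∸1⇒∣^∸1 {d} zero     _     (suc t) = d ∣0
∣∸1⇒∣^∸1 {d} x@(suc _) d∣x∸1 (suc t) =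
  subst (d ∣_) (sym ([m*n]∸1≡m*[n∸1]+[m∸1] x (m^n>0 x t)))
        (∣m∣n⇒∣m+n (∣n⇒∣m*n x (∣∸1⇒∣^∸1 x d∣x∸1 t)) d∣x∸1)

n<m^n : ∀ {m} → 1 < m → ∀ n → n < m ^ n
n<m^n 1<m zero = z<s
n<m^n {m} 1<m (suc n) = begin-strict
  suc n       <⟨ m<m*n (suc n) m 1<m ⟩
  suc n * m   ≤⟨ *-monoˡ-≤ m (n<m^n 1<m n) ⟩
  m ^ n * m   ≡⟨ *-comm (m ^ n) m ⟩
  m ^ suc n   ∎
  where open ≤-Reasoning

^-∸-factor : ∀ m {a j} → a ≤ j → m ^ j ∸ m ^ a ≡ m ^ a * (m ^ (j ∸ a) ∸ 1)
^-∸-factor m {a} {j} a≤j = begin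
  m ^ j ∸ m ^ a                        ≡⟨ cong (λ w → m ^ w ∸ m ^ a) (m+[n∸m]≡n a≤j) ⟨
  m ^ (a + (j ∸ a)) ∸ m ^ a            ≡⟨ cong₂ _∸_ (^-distribˡ-+-* m a (j ∸ a)) (sym (*-identityʳ (m ^ a))) ⟩
  m ^ a * m ^ (j ∸ a) ∸ m ^ a * 1      ≡⟨ *-distribˡ-∸ (m ^ a) (m ^ (j ∸ a)) 1 ⟨
  m ^ a * (m ^ (j ∸ a) ∸ 1)            ∎
  where open ≡-Reasoning

powers-eventually-periodic : ∀ b M .{{_ : NonZero M}} → ∃₂ λ a D → 0 < D × M ∣ b ^ a * (b ^ D ∸ 1)
powers-eventually-periodic b M
  with i , j , i<j , same-residue ← pigeonhole (n<1+n M) (λ k → fromℕ< (m%n<n (b ^ toℕ k) M)) =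
  toℕ i , toℕ j ∸ toℕ i , m<n⇒0<n∸m i<j ,
  subst (M ∣_) (^-∸-factor b (<⇒≤ i<j))
        (%-≡⇒∣∸ M (b ^ toℕ i) (b ^ toℕ j) (fromℕ<-injective _ _ _ _ same-residue))

∃-common-period : ∀ b ℓ → ∃[ D ] (0 < D × (∀ q → Prime q → q ≤ ℓ → ¬ q ∣ b → q ∣ b ^ D ∸ 1))
∃-common-period b ℓ with a , D , 0<D , ℓ!∣ ← powers-eventually-periodic b (ℓ !) {{ℓ !≢0}} =
  D , 0<D , q∣b^D∸1
  where
    q∣b^D∸1 : ∀ q → Prime q → q ≤ ℓ → ¬ q ∣ b → q ∣ b ^ D ∸ 1
    q∣b^D∸1 q q-prime q≤ℓ q∤b
      with euclidsLemma (b ^ a) (b ^ D ∸ 1) q-prime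
             (∣-trans (m≤n⇒m∣n! {{prime⇒nonZero q-prime}} q≤ℓ) ℓ!∣)
    ... | inj₁ q∣b^a   = contradiction (prime∣^⇒∣ b a q-prime q∣b^a) q∤b
    ... | inj₂ q∣b^D∸1 = q∣b^D∸1

module DigitSum (b : ℕ) .{{_ : NonZero b}} (1<b : 1 < b) where

  n/b<n : ∀ m → suc m / b < suc m
  n/b<n m = m/n<m (suc m) b 1<b

  digitSumAux-0 : ∀ f → digitSumAux b f 0 ≡ 0
  digitSumAux-0 zero    = refl
  digitSumAux-0 (suc f) = refl

  digitSumAux-fuel : ∀ f g n → n ≤ f → n ≤ g → digitSumAux b f n ≡ digitSumAux b g n
  digitSumAux-fuel f g zero _ _ = trans (digitSumAux-0 f) (sym (digitSumAux-0 g))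
  digitSumAux-fuel (suc f) (suc g) (suc m) (s≤s m≤f) (s≤s m≤g) =
    cong (suc m % b +_) (digitSumAux-fuel f g (suc m / b) (≤-trans q≤m m≤f) (≤-trans q≤m m≤g))
    where
      q≤m : suc m / b ≤ m
      q≤m = <⇒≤pred (n/b<n m)

  s-unfold : ∀ {n} → 0 < n → s b n ≡ n % b + s b (n / b)
  s-unfold {suc m} _ =
    cong (suc m % b +_) (digitSumAux-fuel m (suc m / b) (suc m / b) (<⇒≤pred (n/b<n m)) ≤-refl)

  s-digit-+ : ∀ {r q} → r < b → 0 < q → s b (r + q * b) ≡ r + s b q
  s-digit-+ {r} {q} r<b 0<q = begin
    s b n                ≡⟨ s-unfold (≤-trans (≤-trans 0<q (m≤m*n q b)) (m≤n+m (q * b) r)) ⟩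
    n % b + s b (n / b)  ≡⟨ cong₂ _+_ (trans ([m+kn]%n≡m%n r q b) (m<n⇒m%n≡m r<b)) (cong (s b) n/b≡q) ⟩
    r + s b q            ∎
    where
      open ≡-Reasoning
      n : ℕ
      n = r + q * b
      n/b≡q : n / b ≡ q
      n/b≡q = trans (+-distrib-/-∣ʳ r (n∣m*n q)) (cong₂ _+_ (m<n⇒m/n≡0 r<b) (m*n/n≡m q b))

  s-^ : ∀ k → s b (b ^ k) ≡ 1
  s-^ zero    = cong (_+ 0) (m<n⇒m%n≡m 1<b)
  s-^ (suc k) = begin
    s b (b * b ^ k)  ≡⟨ cong (s b) (*-comm b (b ^ k)) ⟩
    s b (b ^ k * b)  ≡⟨ s-digit-+ (<-trans z<s 1<b) (m^n>0 b k) ⟩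
    s b (b ^ k)      ≡⟨ s-^ k ⟩
    1                ∎
    where open ≡-Reasoning

  s-^-+ : ∀ k {i} → i < b → s b (b ^ suc k + i) ≡ suc i
  s-^-+ k {i} i<b = begin
    s b (b * b ^ k + i)  ≡⟨ cong (s b) (trans (+-comm _ i) (cong (i +_) (*-comm b (b ^ k)))) ⟩
    s b (i + b ^ k * b)  ≡⟨ s-digit-+ i<b (m^n>0 b k) ⟩
    i + s b (b ^ k)      ≡⟨ cong (i +_) (s-^ k) ⟩
    i + 1                ≡⟨ +-comm i 1 ⟩
    suc i                ∎
    where open ≡-Reasoning

  module _ (d : ℕ) .{{_ : NonZero d}} (d∣b∸1 : d ∣ b ∸ 1) where

    *b-% : ∀ y → (y * b) % d ≡ y % d
    *b-% y = begin
      (y * b) % d                ≡⟨ %-distribˡ-* y b d ⟩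
      (y % d * (b % d)) % d      ≡⟨ cong (λ z → (y % d * z) % d) b%d≡1%d ⟩
      (y % d * (1 % d)) % d      ≡⟨ %-distribˡ-* y 1 d ⟨
      (y * 1) % d                ≡⟨ cong (_% d) (*-identityʳ y) ⟩
      y % d                      ∎
      where
        open ≡-Reasoning
        b%d≡1%d : b % d ≡ 1 % d
        b%d≡1%d = trans (cong (_% d) (sym (m+[n∸m]≡n (<⇒≤ 1<b)))) (%-remove-+ʳ 1 d∣b∸1)

    digitSumAux-% : ∀ f n → n ≤ f → digitSumAux b f n % d ≡ n % d
    digitSumAux-% f zero _ = cong (_% d) (digitSumAux-0 f)
    digitSumAux-% (suc f) n@(suc m) (s≤s m≤f) = begin
      (n % b + digitSumAux b f (n / b)) % d
        ≡⟨ %-cong-+ˡ (n % b) (digitSumAux-% f (n / b) (≤-trans (<⇒≤pred (n/b<n m)) m≤f)) ⟩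
      (n % b + n / b) % d
        ≡⟨ %-cong-+ˡ (n % b) (*b-% (n / b)) ⟨
      (n % b + n / b * b) % d
        ≡⟨ cong (_% d) (m≡m%n+[m/n]*n n b) ⟨
      n % d ∎
      where open ≡-Reasoning

    s-% : ∀ n → s b n % d ≡ n % d
    s-% n = digitSumAux-% n n ≤-refl

    ∣⇒∣s : ∀ {n} → d ∣ n → d ∣ s b n
    ∣⇒∣s {n} d∣n = m%n≡0⇒n∣m (s b n) d (trans (s-% n) (n∣m⇒m%n≡0 n d d∣n))

module _ (b : ℕ) .{{_ : NonZero b}} (1<b : 1 < b) where

  open DigitSum b 1<b

  ¬antiNivenRun-divisor : ∀ {d} .{{_ : NonTrivial d}} n → d ∣ b ∸ 1 → ¬ AntiNivenRun b n d
  ¬antiNivenRun-divisor {d} n d∣b∸1 run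
    with i , i<d , d∣n+i ← ∃-multiple-within n d {{nonTrivial⇒nonZero d}} =
    nonTrivial⇒≢1 (proj₂ (run i i<d) (d∣n+i , ∣⇒∣s d {{nonTrivial⇒nonZero d}} d∣b∸1 d∣n+i))

  module PowerRuns (ℓ : ℕ) (ℓ<b : ℓ < b) (small-primes-∤ : ∀ q → Prime q → q ≤ ℓ → ¬ q ∣ b ∸ 1) where

    D : ℕ
    D = proj₁ (∃-common-period b ℓ)

    0<D : 0 < D
    0<D = proj₁ (proj₂ (∃-common-period b ℓ))

    D-period : ∀ q → Prime q → q ≤ ℓ → ¬ q ∣ b → q ∣ b ^ D ∸ 1
    D-period = proj₂ (proj₂ (∃-common-period b ℓ))

    0<b^ : ∀ k → 0 < b ^ k
    0<b^ = m^n>0 b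

    ¬prime∣b^[1+Dt]∸1 : ∀ t q → Prime q → q ≤ ℓ → ¬ q ∣ b ^ suc (D * t) ∸ 1
    ¬prime∣b^[1+Dt]∸1 t q q-prime q≤ℓ q∣n∸1 with q ∣? b
    ... | yes q∣b = nonTrivial⇒≢1 {{prime⇒nonTrivial q-prime}} (∣1⇒≡1 (∣m+n∣m⇒∣n q∣n q∣n∸1))
      where
        q∣n : q ∣ b ^ suc (D * t) ∸ 1 + 1
        q∣n = subst (q ∣_) (sym (m∸n+n≡m (0<b^ (suc (D * t))))) (∣m⇒∣m*n _ q∣b)
    ... | no q∤b = small-primes-∤ q q-prime q≤ℓ
      (∣m+n∣m⇒∣n (subst (q ∣_) ([m*n]∸1≡m*[n∸1]+[m∸1] b (0<b^ (D * t))) q∣n∸1) (∣n⇒∣m*n b q∣b^Dt∸1))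
      where
        q∣b^Dt∸1 : q ∣ b ^ (D * t) ∸ 1
        q∣b^Dt∸1 = subst (λ w → q ∣ w ∸ 1) (^-*-assoc b D t)
                         (∣∸1⇒∣^∸1 (b ^ D) (D-period q q-prime q≤ℓ q∤b) t)

    antiNivenRun-power : ∀ t → AntiNivenRun b (b ^ suc (D * t)) ℓ
    antiNivenRun-power t i i<ℓ = ≤-trans (0<b^ (suc (D * t))) (m≤m+n _ i) , ¬common-prime⇒coprime no-common
      where
        n : ℕ
        n = b ^ suc (D * t)
        n+i≡[n∸1]+suc-i : n + i ≡ n ∸ 1 + suc i
        n+i≡[n∸1]+suc-i = trans (cong (_+ i) (sym (m+[n∸m]≡n (0<b^ (suc (D * t)))))) (sym (+-suc (n ∸ 1) i))
        no-common : ∀ q → Prime q → q ∣ n + i → q ∣ s b (n + i) → ⊥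
        no-common q q-prime q∣n+i q∣s = ¬prime∣b^[1+Dt]∸1 t q q-prime (≤-trans (∣⇒≤ q∣1+i) i<ℓ)
          (∣m+n∣m⇒∣n (subst (q ∣_) (trans n+i≡[n∸1]+suc-i (+-comm _ (suc i))) q∣n+i) q∣1+i)
          where
            q∣1+i : q ∣ suc i
            q∣1+i = subst (q ∣_) (s-^-+ (D * t) (<-trans i<ℓ ℓ<b)) q∣s

    unbounded-antiNivenRuns : ∀ N → ∃[ n ] (N ≤ n × 0 < n × AntiNivenRun b n ℓ)
    unbounded-antiNivenRuns N = b ^ suc (D * N) , N≤n , 0<b^ (suc (D * N)) , antiNivenRun-power N
      where
        N≤n : N ≤ b ^ suc (D * N)
        N≤n = ≤-trans (m≤n*m N D {{>-nonZero 0<D}}) (≤-trans (n≤1+n _) (<⇒≤ (n<m^n 1<b (suc (D * N)))))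

theorem3p2 : (b : ℕ) → .{{_ : NonZero b}} → 2 < b → (p : ℕ) → Prime p → p ∣ b ∸ 1
           → (∀ q → Prime q → q ∣ b ∸ 1 → p ≤ q)
           → ((∃[ n ] (0 < n × AntiNivenRun b n (p ∸ 1)))
              × (∀ n → 0 < n → ¬ AntiNivenRun b n p))
             × (∀ N → ∃[ n ] (N ≤ n × 0 < n × AntiNivenRun b n (p ∸ 1)))
theorem3p2 b 2<b p p-prime p∣b∸1 p-minimal =
  (map₂ proj₂ (runs 0) , λ n _ → ¬antiNivenRun-divisor b 1<b {{prime⇒nonTrivial p-prime}} n p∣b∸1) , runs
  where
    1<b : 1 < b
    1<b = <-trans (n<1+n 1) 2<b
    p∸1<p : p ∸ 1 < p
    p∸1<p = ∸-monoʳ-< z<s (<⇒≤ (nonTrivial⇒n>1 p {{prime⇒nonTrivial p-prime}}))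
    p∸1<b : p ∸ 1 < b
    p∸1<b = <-≤-trans p∸1<p (≤-trans (∣⇒≤ {{>-nonZero (m<n⇒0<n∸m 1<b)}} p∣b∸1) (m∸n≤m b 1))
    small-primes-∤ : ∀ q → Prime q → q ≤ p ∸ 1 → ¬ q ∣ b ∸ 1
    small-primes-∤ q q-prime q≤p∸1 q∣b∸1 = <⇒≱ (≤-<-trans q≤p∸1 p∸1<p) (p-minimal q q-prime q∣b∸1)
    runs : ∀ N → ∃[ n ] (N ≤ n × 0 < n × AntiNivenRun b n (p ∸ 1))
    runs = PowerRuns.unbounded-antiNivenRuns b 1<b (p ∸ 1) p∸1<b small-primes-∤
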